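{- Let $t,t'$ be $\lambda$-terms such that $t$ reduces to $t'$ (by $\beta$-reduction). Assume that $x_{[i']}$ is an occurrence of the variable $x$ in $t'$ which is a residue of an occurrence $x_{[i]}$ of $x$ in $t$, and that $x_{[i']}$ is pure in $t'$. Then $x_{[i]}$ is pure in $t$.
   Context: For an occurrence $x_{[i]}$ of a variable $x$ in a term $t$, $Arg(x_{[i]},t)$ is the maximal list of arguments of $x_{[i]}$ in $t$, i.e. the sequence $V$ such that $([]\ V)$ is the applicative context of $x_{[i]}$ in $t$. An occurrence $x_{[i]}$ of $x$ in $t$ is pure in $t$ if there is no other occurrence $x_{[j]}$ of $x$ in $t$ such that $x_{[i]}$ occurs inside one of the elements of the list $Arg(x_{[j]},t)$. (Example: in $t=(x_{[1]}\ (x_{[2]}\ y))$, $x_{[1]}$ is pure and $x_{[2]}$ is not.) -}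

module Defs where

open import Data.Nat using (ℕ; zero; suc; _<ᵇ_; _∸_)
open import Data.Bool using (if_then_else_)
open import Data.List using (List; []; _∷_; _++_; replicate; length)
open import Data.Maybe using (Maybe; just; nothing)
open import Data.Product using (∃; ∃-syntax; _×_)
open import Relation.Binary.PropositionalEquality using (_≡_; _≢_)
open import Relation.Binary.Construct.Closure.ReflexiveTransitive using (Star)
open import Relation.Nullary using (¬_)
open import Data.List.Relation.Unary.Unique.Propositional using (Unique)

-- Every variable
-- occurrence carries a label (a natural number) used to track residues:
--   var n ℓ  = occurrence of the variable with de Bruijn index n, label ℓ.
data Term : Set where
  var : ℕ → ℕ → Term
  lam : Term → Term
  app : Term → Term → Term

ext : (ℕ → ℕ) → ℕ → ℕ
ext ρ zero    = zero
ext ρ (suc n) = suc (ρ n)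

rename : (ℕ → ℕ) → Term → Term
rename ρ (var n ℓ) = var (ρ n) ℓ
rename ρ (lam t)   = lam (rename (ext ρ) t)
rename ρ (app t u) = app (rename ρ t) (rename ρ u)

-- A substitution maps (index, label) of an occurrence to a term.
Sub : Set
Sub = ℕ → ℕ → Term

exts : Sub → Sub
exts σ zero    ℓ = var zero ℓ
exts σ (suc n) ℓ = rename suc (σ n ℓ)

subst : Sub → Term → Term
subst σ (var n ℓ) = σ n ℓ
subst σ (lam t)   = lam (subst (exts σ) t)
subst σ (app t u) = app (subst σ t) (subst σ u)

-- b[0 := a]; the surviving occurrences keep their labels,
-- copies of a keep the labels of a.
beta-sub : Term → Sub
beta-sub a zero    ℓ = a
beta-sub a (suc n) ℓ = var n ℓ

_[_] : Term → Term → Term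
b [ a ] = subst (beta-sub a) b

infix 4 _⟶β_ _↠β_
data _⟶β_ : Term → Term → Set where
  β    : ∀ {b a} → app (lam b) a ⟶β b [ a ]
  ξlam : ∀ {t t'} → t ⟶β t' → lam t ⟶β lam t'
  ξl   : ∀ {t t' u} → t ⟶β t' → app t u ⟶β app t' u
  ξr   : ∀ {t u u'} → u ⟶β u' → app t u ⟶β app t u'

_↠β_ : Term → Term → Set
_↠β_ = Star _⟶β_

data Dir : Set where
  body : Dir
  fun  : Dir
  arg  : Dir

Pos : Set
Pos = List Dir

labels : Term → List ℕ
labels (var n ℓ) = ℓ ∷ []
labels (lam t)   = labels t
labels (app t u) = labels t ++ labels u

labelAt : Term → Pos → Maybe ℕ
labelAt (var n ℓ) []        = just ℓ
labelAt (lam t)   (body ∷ p) = labelAt t p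
labelAt (app t u) (fun ∷ p)  = labelAt t p
labelAt (app t u) (arg ∷ p)  = labelAt u p
labelAt _         _          = nothing

-- Identity of the variable of an occurrence: either bound by the λ at a
-- given position, or free with a given (outer) de Bruijn index.
data VarId : Set where
  bound : Pos → VarId
  free  : ℕ → VarId

nth : {A : Set} → List A → ℕ → Maybe A
nth []       _       = nothing
nth (x ∷ xs) zero    = just x
nth (x ∷ xs) (suc n) = nth xs n

-- varAt' binders here t p : binders = positions of enclosing λ's
-- (innermost first), here = position of t in the whole term.
varAt' : List Pos → Pos → Term → Pos → Maybe VarId
varAt' bs here (var n ℓ) [] with nth bs n
... | just b  = just (bound b)
... | nothing = just (free (n ∸ length bs))
varAt' bs here (lam t)   (body ∷ p) = varAt' (here ∷ bs) (here ++ body ∷ []) t p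
varAt' bs here (app t u) (fun ∷ p)  = varAt' bs (here ++ fun ∷ []) t p
varAt' bs here (app t u) (arg ∷ p)  = varAt' bs (here ++ arg ∷ []) u p
varAt' _  _    _         _          = nothing

varAt : Term → Pos → Maybe VarId
varAt t p = varAt' [] [] t p

SameVar : Term → Pos → Pos → Set
SameVar t q p = ∃[ v ] (varAt t q ≡ just v × varAt t p ≡ just v)

-- The occurrence at p lies inside one of the elements of Arg(occurrence at q):
-- the arguments of the occurrence at q are exactly the subterms at positions
-- a ++ [arg] with q = a ++ fun ∷ fun^s.
InArg : Pos → Pos → Set
InArg p q = ∃[ a ] ∃[ s ] ∃[ r ] (q ≡ a ++ replicate (suc s) fun × p ≡ a ++ arg ∷ r)

Pure : Term → Pos → Set
Pure t p = ∀ q → q ≢ p → SameVar t q p → ¬ InArg p q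

-- p' in t' is a residue of p in t (for t with pairwise distinct labels
-- and t ↠β t'): both are variable occurrences carrying the same label.
Residue : Term → Pos → Term → Pos → Set
Residue t p t' p' = ∃[ ℓ ] (labelAt t p ≡ just ℓ × labelAt t' p' ≡ just ℓ)

module Submission where

open import Defs
open import Data.List.Relation.Unary.Unique.Propositional using (Unique)
open import Data.Nat using (ℕ; zero; suc; _+_; _∸_; pred; _≟_)
open import Data.List using (List; []; _∷_; _++_; replicate; length)
open import Data.List.Properties using (++-assoc; ++-identityʳ; ++-cancelˡ)
open import Data.Maybe using (Maybe; just; nothing)
open import Data.Maybe.Properties using (just-injective)
open import Data.Product using (∃-syntax; _×_; _,_; proj₂)
open import Data.Sum using (_⊎_; inj₁; inj₂)
open import Data.Empty using (⊥; ⊥-elim)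
open import Relation.Nullary using (¬_; yes; no)
open import Relation.Binary.PropositionalEquality
  using (_≡_; _≢_; refl; sym; trans; cong) renaming (subst to ≡-subst)
open import Relation.Binary.Construct.Closure.ReflexiveTransitive using (ε; _◅_)
open import Data.List.Relation.Unary.AllPairs using (_∷_)
import Data.List.Relation.Unary.AllPairs as AllPairs
import Data.List.Relation.Unary.All as All
import Data.List.Relation.Unary.All.Properties as All
import Data.List.Relation.Unary.Any as Any
open import Data.List.Membership.Propositional using (_∈_)
open import Data.List.Membership.Propositional.Properties using (∈-++⁺ˡ; ∈-++⁺ʳ)

-- A *clash* for the occurrence at p in t is an occurrence q of
-- the same variable such that p lies inside an argument of q; p is pure iff
-- it has no clash.  We show that impurity is inherited by residues: if every
-- occurrence labelled ℓ in t has a clash, so does every one in a reduct.  For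
-- one step t ⟶β t1 each occurrence p1 of t1 has an *ancestor* p in t with the
-- same label such that (i) a free variable at p is still the variable at p1
-- and (ii) each clash for p yields a clash for p1.  At the redex this is an
-- analysis of substitution (an occurrence of b[a] is kept from b or lies in a
-- copy of a, and clashes are copied along); inside a context the new case is
-- a clash at the head of an application spine, which is a free variable, so
-- (i) applies.  The
-- theorem follows since with distinct labels p is the only occurrence of ℓ.

InArg-∷⁻ : ∀ {d p q} → InArg (d ∷ p) q →
           (d ≡ arg × ∃[ s ] q ≡ replicate (suc s) fun) ⊎ ∃[ q' ] (q ≡ d ∷ q' × InArg p q')
InArg-∷⁻ ([] , s , r , refl , refl) = inj₁ (refl , s , refl)
InArg-∷⁻ ((d ∷ a) , s , r , refl , refl) =
  inj₂ (a ++ replicate (suc s) fun , refl , a , s , r , refl , refl)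

InArg-++ : ∀ {p q} v → InArg p q → InArg (v ++ p) (v ++ q)
InArg-++ v (a , s , r , refl , refl) =
  v ++ a , s , r , sym (++-assoc v a _) , sym (++-assoc v a _)

InArg⇒≢ : ∀ {p q} → InArg p q → q ≢ p
InArg⇒≢ (a , s , r , refl , refl) e with ++-cancelˡ a _ _ e
... | ()

-- Seen from a term T, the variable x of its child in direction d: a bound
-- variable's binder moves one step down; under a λ the free index 0 becomes
-- bound by that λ and the other indices decrease.
liftDir : Dir → VarId → VarId
liftDir d    (bound b)      = bound (d ∷ b)
liftDir body (free zero)    = bound []
liftDir body (free (suc n)) = free n
liftDir fun  (free n)       = free n
liftDir arg  (free n)       = free n

lowerDir : Dir → VarId → VarId
lowerDir _    (bound (_ ∷ b)) = bound b
lowerDir body (bound [])      = free zero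
lowerDir fun  (bound [])      = bound []
lowerDir arg  (bound [])      = bound []
lowerDir body (free n)        = free (suc n)
lowerDir fun  (free n)        = free n
lowerDir arg  (free n)        = free n

lowerDir-liftDir : ∀ d x → lowerDir d (liftDir d x) ≡ x
lowerDir-liftDir d    (bound b)      = refl
lowerDir-liftDir body (free zero)    = refl
lowerDir-liftDir body (free (suc n)) = refl
lowerDir-liftDir fun  (free n)       = refl
lowerDir-liftDir arg  (free n)       = refl

liftDir⁻¹ : ∀ d {x y} → liftDir d x ≡ y → x ≡ lowerDir d y
liftDir⁻¹ d {x} refl = sym (lowerDir-liftDir d x)

liftDir-injective : ∀ d {x y} → liftDir d x ≡ liftDir d y → x ≡ y
liftDir-injective d {y = y} e = trans (liftDir⁻¹ d e) (lowerDir-liftDir d y)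

liftDir-free⁻ : ∀ d {x n} → liftDir d x ≡ free n → ∃[ m ] x ≡ free m
liftDir-free⁻ d {bound b} ()
liftDir-free⁻ d {free m}  _ = m , refl

data Child : Dir → Term → Term → Set where
  in-body : ∀ {t}   → Child body (lam t) t
  in-fun  : ∀ {t u} → Child fun (app t u) t
  in-arg  : ∀ {t u} → Child arg (app t u) u

data Occurs : Term → Pos → ℕ → Set where
  here  : ∀ {n ℓ} → Occurs (var n ℓ) [] ℓ
  there : ∀ {d T t p ℓ} → Child d T t → Occurs t p ℓ → Occurs T (d ∷ p) ℓ

-- Var t p x: the occurrence at p in t is of the variable x, where bound
-- variables are named by the position of their λ relative to t.
data Var : Term → Pos → VarId → Set where
  here  : ∀ {n ℓ} → Var (var n ℓ) [] (free n)
  there : ∀ {d T t p x} → Child d T t → Var t p x → Var T (d ∷ p) (liftDir d x)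

Var-cast : ∀ {t p x y} → x ≡ y → Var t p x → Var t p y
Var-cast e v = ≡-subst (Var _ _) e v

Var-child⁻ : ∀ {d T t p v} → Child d T t → Var T (d ∷ p) v → ∃[ x ] (Var t p x × liftDir d x ≡ v)
Var-child⁻ in-body (there in-body w) = _ , w , refl
Var-child⁻ in-fun  (there in-fun w)  = _ , w , refl
Var-child⁻ in-arg  (there in-arg w)  = _ , w , refl

Var-unique : ∀ {t p x y} → Var t p x → Var t p y → x ≡ y
Var-unique here         here = refl
Var-unique (there ch v) w with Var-child⁻ ch w
... | _ , w' , refl = cong (liftDir _) (Var-unique v w')

Var-sibling : ∀ {d T T1 s p x} → Child d T s → Child d T1 s → Var T (d ∷ p) x → Var T1 (d ∷ p) x
Var-sibling ch ch₁ v with Var-child⁻ ch v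
... | _ , w , refl = there ch₁ w

spine-head-free : ∀ {t x} s → Var t (replicate s fun) x → ∃[ n ] x ≡ free n
spine-head-free zero    here              = _ , refl
spine-head-free (suc s) (there in-fun v) with spine-head-free s v
... | n , refl = n , refl

no-var-on-redex-spine : ∀ {b a x} s → ¬ Var (app (lam b) a) (replicate (suc s) fun) x
no-var-on-redex-spine zero    (there in-fun ())
no-var-on-redex-spine (suc s) (there in-fun (there () _))

spine-stable : ∀ {u u1 x} → u ⟶β u1 → ∀ s → Var u (replicate s fun) x → Var u1 (replicate s fun) x
spine-stable β        zero    ()
spine-stable β        (suc s) v                = ⊥-elim (no-var-on-redex-spine s v)
spine-stable (ξlam _) zero    ()
spine-stable (ξlam _) (suc s) (there () _)
spine-stable (ξl _)   zero    ()
spine-stable (ξl st)  (suc s) (there in-fun v) = there in-fun (spine-stable st s v)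
spine-stable (ξr _)   zero    ()
spine-stable (ξr _)   (suc s) (there in-fun v) = there in-fun v

occurs : ∀ {ℓ} t p → labelAt t p ≡ just ℓ → Occurs t p ℓ
occurs (var n ℓ) []         refl = here
occurs (var n ℓ) (_ ∷ _)    ()
occurs (lam t)   []         ()
occurs (lam t)   (body ∷ p) e    = there in-body (occurs t p e)
occurs (lam t)   (fun ∷ p)  ()
occurs (lam t)   (arg ∷ p)  ()
occurs (app t u) []         ()
occurs (app t u) (body ∷ p) ()
occurs (app t u) (fun ∷ p)  e    = there in-fun (occurs t p e)
occurs (app t u) (arg ∷ p)  e    = there in-arg (occurs u p e)

-- The absolute identity, in the context of varAt' (enclosing binders bs,
-- current position at), of a variable named relative to the current subterm.
resolve : Maybe Pos → ℕ → VarId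
resolve (just b) _ = bound b
resolve nothing  m = free m

globalise : List Pos → Pos → VarId → VarId
globalise bs at (bound b) = bound (at ++ b)
globalise bs at (free n)  = resolve (nth bs n) (n ∸ length bs)

enter : Dir → Pos → List Pos → List Pos
enter body at bs = at ∷ bs
enter fun  _  bs = bs
enter arg  _  bs = bs

globalise-lift : ∀ d bs at x → globalise bs at (liftDir d x) ≡ globalise (enter d at bs) (at ++ d ∷ []) x
globalise-lift d    bs at (bound b)      = cong bound (sym (++-assoc at (d ∷ []) b))
globalise-lift body bs at (free zero)    = cong bound (++-identityʳ at)
globalise-lift body bs at (free (suc n)) = refl
globalise-lift fun  bs at (free n)       = refl
globalise-lift arg  bs at (free n)       = refl

globalise-top : ∀ x → globalise [] [] x ≡ x
globalise-top (bound b) = refl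
globalise-top (free n)  = refl

Var⇒varAt' : ∀ {t p x} bs at → Var t p x → varAt' bs at t p ≡ just (globalise bs at x)
Var⇒varAt' bs at (here {n}) with nth bs n
... | just _  = refl
... | nothing = refl
Var⇒varAt' bs at (there {x = x} in-body v) =
  trans (Var⇒varAt' (at ∷ bs) (at ++ body ∷ []) v) (cong just (sym (globalise-lift body bs at x)))
Var⇒varAt' bs at (there {x = x} in-fun v) =
  trans (Var⇒varAt' bs (at ++ fun ∷ []) v) (cong just (sym (globalise-lift fun bs at x)))
Var⇒varAt' bs at (there {x = x} in-arg v) =
  trans (Var⇒varAt' bs (at ++ arg ∷ []) v) (cong just (sym (globalise-lift arg bs at x)))

varAt'-defined : ∀ {w} bs at t p → varAt' bs at t p ≡ just w → ∃[ x ] Var t p x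
varAt'-defined bs at (var n ℓ) []         _ = free n , here
varAt'-defined bs at (var n ℓ) (_ ∷ _)    ()
varAt'-defined bs at (lam t)   []         ()
varAt'-defined bs at (lam t)   (body ∷ p) e with varAt'-defined _ _ t p e
... | _ , v = _ , there in-body v
varAt'-defined bs at (lam t)   (fun ∷ p)  ()
varAt'-defined bs at (lam t)   (arg ∷ p)  ()
varAt'-defined bs at (app t u) []         ()
varAt'-defined bs at (app t u) (body ∷ p) ()
varAt'-defined bs at (app t u) (fun ∷ p)  e with varAt'-defined _ _ t p e
... | _ , v = _ , there in-fun v
varAt'-defined bs at (app t u) (arg ∷ p)  e with varAt'-defined _ _ u p e
... | _ , v = _ , there in-arg v

Var⇒varAt : ∀ {t p x} → Var t p x → varAt t p ≡ just x
Var⇒varAt {x = x} v = trans (Var⇒varAt' [] [] v) (cong just (globalise-top x))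

varAt⇒Var : ∀ {t p w} → varAt t p ≡ just w → Var t p w
varAt⇒Var {t} {p} e with varAt'-defined [] [] t p e
... | _ , v = Var-cast (just-injective (trans (sym (Var⇒varAt v)) e)) v

unique-++ˡ : ∀ (xs : List ℕ) {ys} → Unique (xs ++ ys) → Unique xs
unique-++ˡ []       _        = AllPairs.[]
unique-++ˡ (x ∷ xs) (px ∷ u) = All.++⁻ˡ xs px ∷ unique-++ˡ xs u

unique-++ʳ : ∀ (xs : List ℕ) {ys} → Unique (xs ++ ys) → Unique ys
unique-++ʳ []       u        = u
unique-++ʳ (x ∷ xs) (_ ∷ u)  = unique-++ʳ xs u

unique-++-disjoint : ∀ (xs : List ℕ) {ys z} → Unique (xs ++ ys) → z ∈ xs → z ∈ ys → ⊥
unique-++-disjoint (x ∷ xs) (px ∷ _) (Any.here refl) z∈ys = All.lookup px (∈-++⁺ʳ xs z∈ys) refl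
unique-++-disjoint (x ∷ xs) (_ ∷ u)  (Any.there z∈xs) z∈ys = unique-++-disjoint xs u z∈xs z∈ys

occurs-∈ : ∀ {t p ℓ} → Occurs t p ℓ → ℓ ∈ labels t
occurs-∈ here                   = Any.here refl
occurs-∈ (there in-body o)      = occurs-∈ o
occurs-∈ (there in-fun o)       = ∈-++⁺ˡ (occurs-∈ o)
occurs-∈ (there (in-arg {t}) o) = ∈-++⁺ʳ (labels t) (occurs-∈ o)

occurs-unique : ∀ {t p p' ℓ} → Unique (labels t) → Occurs t p ℓ → Occurs t p' ℓ → p ≡ p'
occurs-unique U here here = refl
occurs-unique U (there in-body o) (there in-body o') = cong (body ∷_) (occurs-unique U o o')
occurs-unique {app t u} U (there in-fun o) (there in-fun o') =
  cong (fun ∷_) (occurs-unique (unique-++ˡ (labels t) U) o o')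
occurs-unique {app t u} U (there in-arg o) (there in-arg o') =
  cong (arg ∷_) (occurs-unique (unique-++ʳ (labels t) U) o o')
occurs-unique {app t u} U (there in-fun o) (there in-arg o') =
  ⊥-elim (unique-++-disjoint (labels t) U (occurs-∈ o) (occurs-∈ o'))
occurs-unique {app t u} U (there in-arg o) (there in-fun o') =
  ⊥-elim (unique-++-disjoint (labels t) U (occurs-∈ o') (occurs-∈ o))

renameVar : (ℕ → ℕ) → VarId → VarId
renameVar ρ (bound b) = bound b
renameVar ρ (free n)  = free (ρ n)

extDir : Dir → (ℕ → ℕ) → ℕ → ℕ
extDir body ρ = ext ρ
extDir fun  ρ = ρ
extDir arg  ρ = ρ

renameVar-lift : ∀ d ρ x → liftDir d (renameVar (extDir d ρ) x) ≡ renameVar ρ (liftDir d x)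
renameVar-lift d    ρ (bound b)      = refl
renameVar-lift body ρ (free zero)    = refl
renameVar-lift body ρ (free (suc n)) = refl
renameVar-lift fun  ρ (free n)       = refl
renameVar-lift arg  ρ (free n)       = refl

Var-rename : ∀ {t p x} ρ → Var t p x → Var (rename ρ t) p (renameVar ρ x)
Var-rename ρ here = here
Var-rename ρ (there {x = x} in-body v) =
  Var-cast (renameVar-lift body ρ x) (there in-body (Var-rename (ext ρ) v))
Var-rename ρ (there {x = x} in-fun v) =
  Var-cast (renameVar-lift fun ρ x) (there in-fun (Var-rename ρ v))
Var-rename ρ (there {x = x} in-arg v) =
  Var-cast (renameVar-lift arg ρ x) (there in-arg (Var-rename ρ v))

occurs-rename⁻ : ∀ {p ℓ} ρ t → Occurs (rename ρ t) p ℓ → Occurs t p ℓ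
occurs-rename⁻ ρ (var n ℓ) here              = here
occurs-rename⁻ ρ (lam t)   (there in-body o) = there in-body (occurs-rename⁻ (ext ρ) t o)
occurs-rename⁻ ρ (app t u) (there in-fun o)  = there in-fun (occurs-rename⁻ ρ t o)
occurs-rename⁻ ρ (app t u) (there in-arg o)  = there in-arg (occurs-rename⁻ ρ u o)

shift : ℕ → Term → Term
shift zero    a = a
shift (suc k) a = rename suc (shift k a)

-- The variable, in a copy of a placed at position v under k further
-- binders, of an occurrence of the variable y of a.
copyVar : ℕ → Pos → VarId → VarId
copyVar k v (bound w) = bound (v ++ w)
copyVar k v (free m)  = free (k + m)

Var-shift : ∀ {a r y} k → Var a r y → Var (shift k a) r (copyVar k [] y)
Var-shift {y = y} zero v = Var-cast (unshifted y) v
  where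
  unshifted : ∀ y → y ≡ copyVar 0 [] y
  unshifted (bound w) = refl
  unshifted (free m)  = refl
Var-shift {y = y} (suc k) v = Var-cast (shifted y) (Var-rename suc (Var-shift k v))
  where
  shifted : ∀ y → renameVar suc (copyVar k [] y) ≡ copyVar (suc k) [] y
  shifted (bound w) = refl
  shifted (free m)  = refl

occurs-shift⁻ : ∀ {a r ℓ} k → Occurs (shift k a) r ℓ → Occurs a r ℓ
occurs-shift⁻ zero    o = o
occurs-shift⁻ (suc k) o = occurs-shift⁻ k (occurs-rename⁻ suc _ o)

binders : Dir → ℕ
binders body = 1
binders fun  = 0
binders arg  = 0

-- Index renumbering after index k has been substituted away.
dropIndex : ℕ → ℕ → ℕ
dropIndex zero    n       = pred n
dropIndex (suc k) zero    = zero
dropIndex (suc k) (suc n) = suc (dropIndex k n)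

dropVar : ℕ → VarId → VarId
dropVar k (bound b) = bound b
dropVar k (free n)  = free (dropIndex k n)

dropVar-lift : ∀ d k x → liftDir d (dropVar (binders d + k) x) ≡ dropVar k (liftDir d x)
dropVar-lift d    k (bound b)      = refl
dropVar-lift body k (free zero)    = refl
dropVar-lift body k (free (suc n)) = refl
dropVar-lift fun  k (free n)       = refl
dropVar-lift arg  k (free n)       = refl

copyVar-lift : ∀ d k v y → liftDir d (copyVar (binders d + k) v y) ≡ copyVar k (d ∷ v) y
copyVar-lift d    k v (bound w) = refl
copyVar-lift body k v (free m)  = refl
copyVar-lift fun  k v (free m)  = refl
copyVar-lift arg  k v (free m)  = refl

-- σ substitutes a for index k, under k binders, as β-reduction does for the
-- index 0 of the body of the redex after descending under k binders.
record Replaces (a : Term) (k : ℕ) (σ : Sub) : Set where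
  field
    replaced   : ∀ ℓ → σ k ℓ ≡ shift k a
    renumbered : ∀ n ℓ → n ≢ k → σ n ℓ ≡ var (dropIndex k n) ℓ
open Replaces

beta-replaces : ∀ a → Replaces a 0 (beta-sub a)
beta-replaces a = record { replaced = λ _ → refl ; renumbered = renumber }
  where
  renumber : ∀ n ℓ → n ≢ 0 → beta-sub a n ℓ ≡ var (dropIndex 0 n) ℓ
  renumber zero    ℓ n≢0 = ⊥-elim (n≢0 refl)
  renumber (suc n) ℓ _   = refl

exts-replaces : ∀ {a k σ} → Replaces a k σ → Replaces a (suc k) (exts σ)
exts-replaces {a} {k} {σ} R = record
  { replaced = λ ℓ → cong (rename suc) (replaced R ℓ) ; renumbered = renumber }
  where
  renumber : ∀ n ℓ → n ≢ suc k → exts σ n ℓ ≡ var (dropIndex (suc k) n) ℓ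
  renumber zero    ℓ _ = refl
  renumber (suc n) ℓ n≢k = cong (rename suc) (renumbered R n ℓ (λ e → n≢k (cong suc e)))

data Origin (a b : Term) (k : ℕ) (p : Pos) (ℓ : ℕ) : Set where
  kept   : ∀ {x} → Occurs b p ℓ → Var b p x → x ≢ free k → Origin a b k p ℓ
  copied : ∀ {v r} → p ≡ v ++ r → Var b v (free k) → Occurs a r ℓ → Origin a b k p ℓ

subst-origin : ∀ {a k σ p ℓ} → Replaces a k σ → ∀ b → Occurs (subst σ b) p ℓ → Origin a b k p ℓ
subst-origin {k = k} {p = p} {ℓ} R (var n ℓ') o with n ≟ k
... | yes refl = copied refl here (occurs-shift⁻ n (≡-subst (λ T → Occurs T p ℓ) (replaced R ℓ') o))
... | no n≢k with ≡-subst (λ T → Occurs T p ℓ) (renumbered R n ℓ' n≢k) o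
...   | here = kept here here (λ { refl → n≢k refl })
subst-origin R (lam b) (there in-body o) with subst-origin (exts-replaces R) b o
... | kept ob vb x≢k        = kept (there in-body ob) (there in-body vb) (λ e → x≢k (liftDir⁻¹ body e))
... | copied refl vv oa     = copied refl (there in-body vv) oa
subst-origin R (app b c) (there in-fun o) with subst-origin R b o
... | kept ob vb x≢k        = kept (there in-fun ob) (there in-fun vb) (λ e → x≢k (liftDir⁻¹ fun e))
... | copied refl vv oa     = copied refl (there in-fun vv) oa
subst-origin R (app b c) (there in-arg o) with subst-origin R c o
... | kept ob vb x≢k        = kept (there in-arg ob) (there in-arg vb) (λ e → x≢k (liftDir⁻¹ arg e))
... | copied refl vv oa     = copied refl (there in-arg vv) oa

Var-subst-kept : ∀ {a k σ q x} → Replaces a k σ → ∀ {b} → Var b q x → x ≢ free k →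
                 Var (subst σ b) q (dropVar k x)
Var-subst-kept R (here {n} {ℓ}) x≢k =
  ≡-subst (λ T → Var T [] _) (sym (renumbered R n ℓ (λ e → x≢k (cong free e)))) here
Var-subst-kept {k = k} R (there {x = x} in-body v) x≢k =
  Var-cast (dropVar-lift body k x)
    (there in-body (Var-subst-kept (exts-replaces R) v (λ e → x≢k (cong (liftDir body) e))))
Var-subst-kept {k = k} R (there {x = x} in-fun v) x≢k =
  Var-cast (dropVar-lift fun k x) (there in-fun (Var-subst-kept R v (λ e → x≢k (cong (liftDir fun) e))))
Var-subst-kept {k = k} R (there {x = x} in-arg v) x≢k =
  Var-cast (dropVar-lift arg k x) (there in-arg (Var-subst-kept R v (λ e → x≢k (cong (liftDir arg) e))))

Var-subst-copy : ∀ {a k σ v x r y} → Replaces a k σ → ∀ {b} → Var b v x → x ≡ free k →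
                 Var a r y → Var (subst σ b) (v ++ r) (copyVar k v y)
Var-subst-copy {k = k} {r = r} R (here {ℓ = ℓ}) refl w =
  ≡-subst (λ T → Var T r _) (sym (replaced R ℓ)) (Var-shift k w)
Var-subst-copy {k = k} {v = body ∷ v} {y = y} R (there in-body u) e w =
  Var-cast (copyVar-lift body k v y)
    (there in-body (Var-subst-copy (exts-replaces R) u (liftDir⁻¹ body e) w))
Var-subst-copy {k = k} {v = fun ∷ v} {y = y} R (there in-fun u) e w =
  Var-cast (copyVar-lift fun k v y) (there in-fun (Var-subst-copy R u (liftDir⁻¹ fun e) w))
Var-subst-copy {k = k} {v = arg ∷ v} {y = y} R (there in-arg u) e w =
  Var-cast (copyVar-lift arg k v y) (there in-arg (Var-subst-copy R u (liftDir⁻¹ arg e) w))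

record Clash (t : Term) (q p : Pos) : Set where
  constructor clash
  field
    inArg : InArg p q
    {shared} : VarId
    at-q  : Var t q shared
    at-p  : Var t p shared

impure⇒clash : ∀ {t q p} → SameVar t q p → InArg p q → Clash t q p
impure⇒clash (_ , eq , ep) ia = clash ia (varAt⇒Var eq) (varAt⇒Var ep)

clash⇒impure : ∀ {t q p} → Clash t q p → ¬ Pure t p
clash⇒impure {q = q} (clash ia vq vp) pure = pure q (InArg⇒≢ ia) (_ , Var⇒varAt vq , Var⇒varAt vp) ia

clash-into : ∀ {d T t q p} → Child d T t → Clash t q p → Clash T (d ∷ q) (d ∷ p)
clash-into ch (clash ia vq vp) = clash (InArg-++ (_ ∷ []) ia) (there ch vq) (there ch vp)

clash-out-of : ∀ {d T t q p} → Child d T t → Clash T q (d ∷ p) →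
               (d ≡ arg × ∃[ s ] q ≡ replicate (suc s) fun) ⊎ ∃[ q' ] (q ≡ d ∷ q' × Clash t q' p)
clash-out-of {d} ch (clash ia vq vp) with InArg-∷⁻ ia
... | inj₁ on-spine = inj₁ on-spine
... | inj₂ (q' , refl , ia') with Var-child⁻ ch vq | Var-child⁻ ch vp
...   | _ , wq , eq | _ , wp , ep =
        inj₂ (q' , refl , clash ia' (Var-cast (liftDir-injective d (trans eq (sym ep))) wq) wp)

clash-kept : ∀ {a k σ b q p x} → Replaces a k σ → Var b p x → x ≢ free k →
             Clash b q p → Clash (subst σ b) q p
clash-kept {k = k} R vp x≢k (clash ia {y} wq wp) =
  clash ia (Var-subst-kept R wq y≢k) (Var-subst-kept R wp y≢k)
  where
  y≢k : y ≢ free k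
  y≢k e = x≢k (trans (Var-unique vp wp) e)

clash-copied : ∀ {a k σ b v q r} → Replaces a k σ → Var b v (free k) →
               Clash a q r → Clash (subst σ b) (v ++ q) (v ++ r)
clash-copied {v = v} R vv (clash ia wq wr) =
  clash (InArg-++ v ia) (Var-subst-copy R vv refl wq) (Var-subst-copy R vv refl wr)

record Tracks (t t1 : Term) (p p1 : Pos) : Set where
  field
    keeps-free  : ∀ {n} → Var t p (free n) → Var t1 p1 (free n)
    moves-clash : ∀ {q} → Clash t q p → ∃[ q1 ] Clash t1 q1 p1
open Tracks

keeps-free-child : ∀ {d T T1 t t1 p p1 n} → Child d T t → Child d T1 t1 →
                   (∀ {m} → Var t p (free m) → Var t1 p1 (free m)) →
                   Var T (d ∷ p) (free n) → Var T1 (d ∷ p1) (free n)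
keeps-free-child {d} ch ch₁ keep v with Var-child⁻ ch v
... | _ , w , e with liftDir-free⁻ d e
...   | _ , refl = Var-cast e (there ch₁ (keep w))

track-child : ∀ {d T T1 t t1 p p1} → T ⟶β T1 → Child d T t → Child d T1 t1 →
              Tracks t t1 p p1 → Tracks T T1 (d ∷ p) (d ∷ p1)
track-child {d} {T} {T1} {p = p} {p1} st ch ch₁ tr =
  record { keeps-free = keeps-free-child ch ch₁ (keeps-free tr) ; moves-clash = move }
  where
  move : ∀ {q} → Clash T q (d ∷ p) → ∃[ q1 ] Clash T1 q1 (d ∷ p1)
  move c with clash-out-of ch c
  ... | inj₂ (_ , refl , inner) with moves-clash tr inner
  ...   | q1 , c1 = d ∷ q1 , clash-into ch₁ c1
  move (clash _ vq vp) | inj₁ (refl , s , refl) with spine-head-free (suc s) vq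
  ...   | _ , refl = replicate (suc s) fun ,
          clash ([] , s , p1 , refl , refl) (spine-stable st (suc s) vq)
                (keeps-free-child ch ch₁ (keeps-free tr) vp)

track-beside : ∀ {d T T1 s r} → T ⟶β T1 → Child d T s → Child d T1 s → Tracks T T1 (d ∷ r) (d ∷ r)
track-beside {d} {T} {T1} {r = r} st ch ch₁ =
  record { keeps-free = Var-sibling ch ch₁ ; moves-clash = move }
  where
  move : ∀ {q} → Clash T q (d ∷ r) → ∃[ q1 ] Clash T1 q1 (d ∷ r)
  move (clash ia vq vp) = _ , clash ia (witness (InArg-∷⁻ ia) vq) (Var-sibling ch ch₁ vp)
    where
    witness : ∀ {q v} →
              (d ≡ arg × ∃[ s ] q ≡ replicate (suc s) fun) ⊎ ∃[ q' ] (q ≡ d ∷ q' × InArg r q') →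
              Var T q v → Var T1 q v
    witness (inj₁ (_ , s , refl)) = spine-stable st (suc s)
    witness (inj₂ (_ , refl , _)) = Var-sibling ch ch₁

track-kept : ∀ {a b p x} → Var b p x → x ≢ free 0 →
             Tracks (app (lam b) a) (b [ a ]) (fun ∷ body ∷ p) p
track-kept {a} {b} {p} vb x≢0 = record { keeps-free = keep ; moves-clash = move }
  where
  keep : ∀ {n} → Var (app (lam b) a) (fun ∷ body ∷ p) (free n) → Var (b [ a ]) p (free n)
  keep v with Var-child⁻ in-fun v
  ... | _ , v' , e₁ with Var-child⁻ in-body v'
  ...   | _ , w , e₂ with liftDir⁻¹ body (trans e₂ (liftDir⁻¹ fun e₁))
  ...     | refl = Var-subst-kept (beta-replaces a) w (λ e → x≢0 (trans (Var-unique vb w) e))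
  move : ∀ {q} → Clash (app (lam b) a) q (fun ∷ body ∷ p) → ∃[ q1 ] Clash (b [ a ]) q1 p
  move c with clash-out-of in-fun c
  ... | inj₁ (() , _)
  ... | inj₂ (_ , refl , c') with clash-out-of in-body c'
  ...   | inj₁ (() , _)
  ...   | inj₂ (q , refl , c'') = q , clash-kept (beta-replaces a) vb x≢0 c''

track-copied : ∀ {a b v r} → Var b v (free 0) → Tracks (app (lam b) a) (b [ a ]) (arg ∷ r) (v ++ r)
track-copied {a} {b} {v} {r} vv = record { keeps-free = keep ; moves-clash = move }
  where
  keep : ∀ {n} → Var (app (lam b) a) (arg ∷ r) (free n) → Var (b [ a ]) (v ++ r) (free n)
  keep w with Var-child⁻ in-arg w
  ... | _ , w' , e with liftDir⁻¹ arg e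
  ...   | refl = Var-subst-copy (beta-replaces a) vv refl w'
  move : ∀ {q} → Clash (app (lam b) a) q (arg ∷ r) → ∃[ q1 ] Clash (b [ a ]) q1 (v ++ r)
  move c with clash-out-of in-arg c
  ... | inj₁ (_ , s , refl) = ⊥-elim (no-var-on-redex-spine s (Clash.at-q c))
  ... | inj₂ (q , refl , c') = v ++ q , clash-copied (beta-replaces a) vv c'

Ancestry : Term → Term → Set
Ancestry t t1 = ∀ {p1 ℓ} → Occurs t1 p1 ℓ → ∃[ p ] (Occurs t p ℓ × Tracks t t1 p p1)

ancestry : ∀ {t t1} → t ⟶β t1 → Ancestry t t1
ancestry (β {b} {a}) o with subst-origin (beta-replaces a) b o
... | kept ob vb x≢0 = _ , there in-fun (there in-body ob) , track-kept vb x≢0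
... | copied refl vv oa = _ , there in-arg oa , track-copied vv
ancestry st@(ξlam st') (there in-body o) with ancestry st' o
... | _ , o' , tr = _ , there in-body o' , track-child st in-body in-body tr
ancestry st@(ξl st') (there in-fun o) with ancestry st' o
... | _ , o' , tr = _ , there in-fun o' , track-child st in-fun in-fun tr
ancestry st@(ξl _)   (there in-arg o) = _ , there in-arg o , track-beside st in-arg in-arg
ancestry st@(ξr _)   (there in-fun o) = _ , there in-fun o , track-beside st in-fun in-fun
ancestry st@(ξr st') (there in-arg o) with ancestry st' o
... | _ , o' , tr = _ , there in-arg o' , track-child st in-arg in-arg tr

AllImpure : Term → ℕ → Set
AllImpure t ℓ = ∀ {p} → Occurs t p ℓ → ∃[ q ] Clash t q p

impure-step : ∀ {t t1 ℓ} → t ⟶β t1 → AllImpure t ℓ → AllImpure t1 ℓ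
impure-step st impure o1 with ancestry st o1
... | _ , o , tr with impure o
...   | _ , c = moves-clash tr c

impure-along : ∀ {t t1 ℓ} → t ↠β t1 → AllImpure t ℓ → AllImpure t1 ℓ
impure-along ε           impure = impure
impure-along (st ◅ rest) impure = impure-along rest (impure-step st impure)

sole-occurrence : ∀ {t p q ℓ} → Unique (labels t) → Occurs t p ℓ → Clash t q p → AllImpure t ℓ
sole-occurrence U o c o' with occurs-unique U o o'
... | refl = _ , c

lemma2p4 : (t t' : Term) → Unique (labels t) → t ↠β t' →
    (p p' : Pos) → Residue t p t' p' → Pure t' p' → Pure t p
lemma2p4 t t' U red p p' (ℓ , lp , lp') pure' q _ same inArg =
  clash⇒impure (proj₂ clash-in-t') pure'
  where
  impure-in-t : AllImpure t ℓ
  impure-in-t = sole-occurrence U (occurs t p lp) (impure⇒clash same inArg)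
  clash-in-t' : ∃[ q' ] Clash t' q' p'
  clash-in-t' = impure-along red impure-in-t (occurs t' p' lp')
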